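{- Let $G$ be a simple connected graph with $m\ge1$ edges and let $v\in V(G)$. Let $\widehat G$ be the graph obtained from $G$ by attaching three new pendant vertices $a,b,c$ to $v$ and then adding the edges $\{a,b\}$ and $\{b,c\}$. Then $$\mathscr{K}(\widehat G)=\frac{4m\mathscr{K}(G)+20\mu(G,v)+16m+47}{4m+20}.$$
   Context: For a connected graph $H$, effective resistance $r_H(i,j)=(e_i-e_j)^TL^\dagger(e_i-e_j)$ with $L^\dagger$ the Moore–Penrose pseudoinverse of the Laplacian. For connected $H$ with $m\ge1$ edges and degrees $d_i$, Kemeny's constant $\mathscr{K}(H)=\sum_j\pi_jm_{ij}$ for the simple random walk ($\pi_j=d_j/2m$, $m_{ij}$ expected hitting time, $m_{jj}=0$), equal to $\frac1{4m}\sum_{i,j}d_id_jr_H(i,j)$. Moment: $\mu(H,v)=\sum_{i\in V(H)}d_ir_H(i,v)$. -}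

module Defs where

open import Data.Nat as ℕ using (ℕ; zero; suc)
open import Data.Integer using (+_)
open import Data.Rational using (ℚ; 0ℚ; _+_; _*_; _-_; -_; _/_)
open import Data.Fin using (Fin; _<?_; _≟_) renaming (zero to fz; suc to fs)
open import Data.Bool using (Bool; true; false; if_then_else_; _∧_)
open import Relation.Nullary using (does)
open import Relation.Binary.PropositionalEquality using (_≡_)

Adj : ℕ → Set
Adj n = Fin n → Fin n → Bool

IsSimple : ∀ {n} → Adj n → Set
IsSimple {n} A = (∀ i → A i i ≡ false) × (∀ i j → A i j ≡ A j i)
  where open import Data.Product using (_×_)

data Reach {n} (A : Adj n) : Fin n → Fin n → Set where
  here : ∀ {i} → Reach A i i
  step : ∀ {i k j} → A i k ≡ true → Reach A k j → Reach A i j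

IsConnected : ∀ {n} → Adj n → Set
IsConnected {n} A = ∀ (i j : Fin n) → Reach A i j

sumℕ : ∀ {n} → (Fin n → ℕ) → ℕ
sumℕ {zero} f = zero
sumℕ {suc n} f = f fz ℕ.+ sumℕ (λ i → f (fs i))

sumℚ : ∀ {n} → (Fin n → ℚ) → ℚ
sumℚ {zero} f = 0ℚ
sumℚ {suc n} f = f fz + sumℚ (λ i → f (fs i))

b2ℕ : Bool → ℕ
b2ℕ true = 1
b2ℕ false = 0

ℕtoℚ : ℕ → ℚ
ℕtoℚ k = + k / 1

-- reciprocal of a natural number (1/0 := 0, never used under m ≥ 1)
recip : ℕ → ℚ
recip zero = 0ℚ
recip (suc k) = + 1 / suc k

degree : ∀ {n} → Adj n → Fin n → ℕ
degree A i = sumℕ (λ j → b2ℕ (A i j))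

edgeCount : ∀ {n} → Adj n → ℕ
edgeCount A = sumℕ (λ i → sumℕ (λ j → b2ℕ (does (i <? j) ∧ A i j)))

Matrix : ℕ → Set
Matrix n = Fin n → Fin n → ℚ

_·_ : ∀ {n} → Matrix n → Matrix n → Matrix n
(M · N) i j = sumℚ (λ k → M i k * N k j)

laplacian : ∀ {n} → Adj n → Matrix n
laplacian A i j =
  if does (i ≟ j) then ℕtoℚ (degree A i)
  else (if A i j then - ℕtoℚ 1 else 0ℚ)

-- X is the Moore–Penrose pseudoinverse of M (the four Penrose equations;
-- for real matrices they determine X uniquely)
IsPseudoInverse : ∀ {n} → Matrix n → Matrix n → Set
IsPseudoInverse M X =
  (∀ i j → (M · (X · M)) i j ≡ M i j) ×
  (∀ i j → (X · (M · X)) i j ≡ X i j) ×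
  (∀ i j → (M · X) i j ≡ (M · X) j i) ×
  (∀ i j → (X · M) i j ≡ (X · M) j i)
  where open import Data.Product using (_×_)

-- effective resistance r(i,j) = (e_i - e_j)^T L† (e_i - e_j), with L† = X
resistance : ∀ {n} → Matrix n → Fin n → Fin n → ℚ
resistance X i j = (X i i + X j j) - (X i j + X j i)

kemeny : ∀ {n} → Adj n → Matrix n → ℚ
kemeny A X = recip (4 ℕ.* edgeCount A) *
  sumℚ (λ i → sumℚ (λ j →
    ℕtoℚ (degree A i) * ℕtoℚ (degree A j) * resistance X i j))

moment : ∀ {n} → Adj n → Matrix n → Fin n → ℚ
moment A X v = sumℚ (λ i → ℕtoℚ (degree A i) * resistance X i v)

-- Ĝ: vertices of G are embedded as fs (fs (fs i)); new vertices
-- a = fz, b = fs fz, c = fs (fs fz). Edges: G's edges, av, bv, cv, ab, bc.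
hat : ∀ {n} → Adj n → Fin n → Adj (suc (suc (suc n)))
hat A v (fs (fs (fs i))) (fs (fs (fs j))) = A i j
hat A v (fs (fs (fs i))) _ = does (i ≟ v)
hat A v _ (fs (fs (fs j))) = does (j ≟ v)
hat A v fz (fs fz) = true
hat A v (fs fz) fz = true
hat A v (fs fz) (fs (fs fz)) = true
hat A v (fs (fs fz)) (fs fz) = true
hat A v _ _ = false

{-# OPTIONS --safe #-}
module Submission where

-- Resistances are read off potentials: if L p = e_s - e_t then r(s,t) = p s - p t for every Y
-- with L Y L = L, since r(s,t) = fᵀ Y f = pᵀ L Y L p = pᵀ f for f = e_s - e_t. For connected G the
-- vector X f is such a potential: f - L X f is harmonic with zero sum, hence zero.
-- In Ĝ the gadget a - b - c hangs off the cut vertex v, so potentials of Ĝ are assembled from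
-- potentials of G, shifted by constants on the gadget, and from the inverse of the gadget
-- Laplacian with v grounded. Hence r̂ = r on G, r̂(x,t) = g_x + r(v,t) with g = (5/8, 1/2, 5/8),
-- and r̂(a,b) = r̂(b,c) = 5/8, r̂(a,c) = 1. With d̂ = (2,3,2) on the gadget, d̂ = d + 3 δ_v on G
-- and Σ d = 2m, the sum Σ d̂_i d̂_j r̂_ij splits into the blocks gadget × gadget = 23,
-- gadget × G = G × gadget = 4 (2m + 3) + 7 μ and G × G = Σ d_i d_j r_ij + 6 μ.

open import Defs
open import Data.Nat using (ℕ; suc; _≤_) renaming (_*_ to _*ℕ_; _+_ to _+ℕ_)
open import Data.Fin using (Fin)
open import Data.Rational using (_+_; _*_)
open import Relation.Binary.PropositionalEquality using (_≡_)

open import Algebra.Bundles using (CommutativeRing)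
import Algebra.Properties.Group as GroupProperties
import Algebra.Properties.Semiring.Sum as SemiringSum
open import Data.Bool using (Bool; true; false; _∧_)
open import Data.Empty using (⊥-elim)
open import Data.Fin using (_≟_; _<?_; _↑ˡ_; _↑ʳ_) renaming (zero to fz; suc to fs)
import Data.Fin.Properties as Finₚ
import Data.Integer as ℤ
import Data.Integer.Properties as ℤ
open import Data.List using (allFin)
import Data.List.Extrema as Extrema
open import Data.List.Membership.Propositional.Properties using (∈-allFin)
import Data.List.Relation.Unary.All as All
open import Data.Nat using (zero; s≤s; z≤n)
import Data.Nat.Coprimality as Coprime
import Data.Nat.Properties as ℕ
open import Data.Product using (_×_; _,_; proj₁; proj₂)
open import Data.Rational using (ℚ; 0ℚ; 1ℚ; mkℚ; _-_; -_; _/_) renaming (_≤_ to _≤ℚ_)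
import Data.Rational.Properties as ℚ
open import Data.Vec using ([]; _∷_)
import Data.Vec as Vec
open import Data.Vec.Functional using (_++_)
open import Data.Vec.Functional.Properties using (lookup-++ˡ)
open import Function using (_∘_)
open import Level using (0ℓ)
open import Relation.Binary.Bundles using (DecTotalOrder)
open import Relation.Binary.Definitions using (tri<; tri≈; tri>)
open import Relation.Binary.PropositionalEquality
  using (_≗_; refl; sym; trans; cong; cong₂; subst; subst₂; module ≡-Reasoning)
open import Relation.Nullary.Decidable
  using (does; yes; no; dec⇒maybe; dec-true; dec-false; toWitness)
open import Tactic.RingSolver using (solve-∀)
open import Tactic.RingSolver.Core.AlmostCommutativeRing
  using (AlmostCommutativeRing; fromCommutativeRing)

open ≡-Reasoning

module ℚ-Group = GroupProperties ℚ.+-0-group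
module ℚ-Extrema = Extrema (DecTotalOrder.totalOrder ℚ.≤-decTotalOrder)
module ΣQ = SemiringSum (CommutativeRing.semiring ℚ.+-*-commutativeRing)
module ΣN = SemiringSum ℕ.+-*-semiring

ℚ-ring : AlmostCommutativeRing 0ℓ 0ℓ
ℚ-ring = fromCommutativeRing ℚ.+-*-commutativeRing (λ x → dec⇒maybe (0ℚ ℚ.≟ x))

ℕtoℚ≡mkℚ : ∀ k → ℕtoℚ k ≡ mkℚ (ℤ.+ k) 0 (Coprime.sym (Coprime.1-coprimeTo k))
ℕtoℚ≡mkℚ k = ℚ.normalize-coprime _

ℕtoℚ-homo-+ : ∀ a b → ℕtoℚ (a +ℕ b) ≡ ℕtoℚ a + ℕtoℚ b
ℕtoℚ-homo-+ a b = begin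
  ℤ.+ (a +ℕ b) / 1
    ≡⟨ cong (_/ 1) (ℤ.pos-+ a b) ⟩
  (ℤ.+ a ℤ.+ ℤ.+ b) / 1
    ≡⟨ cong (_/ 1) (cong₂ ℤ._+_ (ℤ.*-identityʳ (ℤ.+ a)) (ℤ.*-identityʳ (ℤ.+ b))) ⟨
  (ℤ.+ a ℤ.* ℤ.+ 1 ℤ.+ ℤ.+ b ℤ.* ℤ.+ 1) / 1
    ≡⟨ cong₂ _+_ (ℕtoℚ≡mkℚ a) (ℕtoℚ≡mkℚ b) ⟨
  ℕtoℚ a + ℕtoℚ b ∎

ℕtoℚ-homo-* : ∀ a b → ℕtoℚ (a *ℕ b) ≡ ℕtoℚ a * ℕtoℚ b
ℕtoℚ-homo-* a b = begin
  ℤ.+ (a *ℕ b) / 1         ≡⟨ cong (_/ 1) (ℤ.pos-* a b) ⟩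
  (ℤ.+ a ℤ.* ℤ.+ b) / 1    ≡⟨ cong₂ _*_ (ℕtoℚ≡mkℚ a) (ℕtoℚ≡mkℚ b) ⟨
  ℕtoℚ a * ℕtoℚ b          ∎

ℕtoℚ*recip : ∀ {k} → 1 ≤ k → ℕtoℚ k * recip k ≡ 1ℚ
ℕtoℚ*recip {suc k} _ =
  trans (cong₂ _*_ (ℕtoℚ≡mkℚ (suc k)) (ℚ.normalize-coprime (Coprime.1-coprimeTo (suc k))))
        (ℚ.*-inverseʳ (mkℚ (ℤ.+ suc k) 0 (Coprime.sym (Coprime.1-coprimeTo (suc k)))))

suc*x≡0⇒x≡0 : ∀ k {x} → ℕtoℚ (suc k) * x ≡ 0ℚ → x ≡ 0ℚ
suc*x≡0⇒x≡0 k {x} kx≡0 = begin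
  x
    ≡⟨ ℚ.*-identityˡ x ⟨
  1ℚ * x
    ≡⟨ cong (_* x) (trans (ℚ.*-comm (recip (suc k)) (ℕtoℚ (suc k)))
                          (ℕtoℚ*recip {suc k} (s≤s z≤n))) ⟨
  recip (suc k) * ℕtoℚ (suc k) * x
    ≡⟨ ℚ.*-assoc (recip (suc k)) _ x ⟩
  recip (suc k) * (ℕtoℚ (suc k) * x)
    ≡⟨ cong (recip (suc k) *_) kx≡0 ⟩
  recip (suc k) * 0ℚ
    ≡⟨ ℚ.*-zeroʳ (recip (suc k)) ⟩
  0ℚ ∎

b2ℚ : Bool → ℚ
b2ℚ b = ℕtoℚ (b2ℕ b)

δ : ∀ {n} → Fin n → Fin n → ℚ
δ i j = b2ℚ (does (i ≟ j))

δ-sym : ∀ {n} (i j : Fin n) → δ i j ≡ δ j i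
δ-sym fz fz = refl
δ-sym fz (fs j) = refl
δ-sym (fs i) fz = refl
δ-sym (fs i) (fs j) = δ-sym i j

δ-*-transport : ∀ {n} (i j : Fin n) (f : Fin n → ℚ) → δ i j * f i ≡ δ i j * f j
δ-*-transport i j f with i ≟ j
... | yes refl = refl
... | no _ = trans (ℚ.*-zeroˡ (f i)) (sym (ℚ.*-zeroˡ (f j)))

δ-↑ˡ : ∀ {m} n (x y : Fin m) → δ (x ↑ˡ n) (y ↑ˡ n) ≡ δ x y
δ-↑ˡ n fz fz = refl
δ-↑ˡ n fz (fs y) = refl
δ-↑ˡ n (fs x) fz = refl
δ-↑ˡ n (fs x) (fs y) = δ-↑ˡ n x y

δ-↑ˡ↑ʳ : ∀ {m n} (x : Fin m) (j : Fin n) → δ (x ↑ˡ n) (m ↑ʳ j) ≡ 0ℚ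
δ-↑ˡ↑ʳ fz j = refl
δ-↑ˡ↑ʳ (fs x) j = δ-↑ˡ↑ʳ x j

δ-↑ʳ↑ˡ : ∀ {m n} (j : Fin n) (x : Fin m) → δ (m ↑ʳ j) (x ↑ˡ n) ≡ 0ℚ
δ-↑ʳ↑ˡ j fz = refl
δ-↑ʳ↑ˡ j (fs x) = δ-↑ʳ↑ˡ j x

splitAt-≗ : ∀ m {n} {a} {B : Set a} {f g : Fin (m +ℕ n) → B} →
  (∀ x → f (x ↑ˡ n) ≡ g (x ↑ˡ n)) → (∀ i → f (m ↑ʳ i) ≡ g (m ↑ʳ i)) → f ≗ g
splitAt-≗ zero on-left on-right i = on-right i
splitAt-≗ (suc m) on-left on-right fz = on-left fz
splitAt-≗ (suc m) on-left on-right (fs i) = splitAt-≗ m (on-left ∘ fs) on-right i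

sumℚ≡sum : ∀ {n} (f : Fin n → ℚ) → sumℚ f ≡ ΣQ.sum f
sumℚ≡sum {zero} f = refl
sumℚ≡sum {suc n} f = cong (f fz +_) (sumℚ≡sum (f ∘ fs))

sumℕ≡sum : ∀ {n} (f : Fin n → ℕ) → sumℕ f ≡ ΣN.sum f
sumℕ≡sum {zero} f = refl
sumℕ≡sum {suc n} f = cong (f fz +ℕ_) (sumℕ≡sum (f ∘ fs))

sumℚ-cong : ∀ {n} {f g : Fin n → ℚ} → f ≗ g → sumℚ f ≡ sumℚ g
sumℚ-cong {f = f} {g} f≗g = begin
  sumℚ f    ≡⟨ sumℚ≡sum f ⟩
  ΣQ.sum f  ≡⟨ ΣQ.sum-cong-≗ f≗g ⟩
  ΣQ.sum g  ≡⟨ sumℚ≡sum g ⟨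
  sumℚ g    ∎

sumℚ-zero : ∀ n → sumℚ {n} (λ _ → 0ℚ) ≡ 0ℚ
sumℚ-zero n = trans (sumℚ≡sum {n} (λ _ → 0ℚ)) (ΣQ.sum-replicate-zero n)

sumℚ-distrib-+ : ∀ {n} (f g : Fin n → ℚ) → sumℚ (λ i → f i + g i) ≡ sumℚ f + sumℚ g
sumℚ-distrib-+ f g = begin
  sumℚ (λ i → f i + g i)    ≡⟨ sumℚ≡sum (λ i → f i + g i) ⟩
  ΣQ.sum (λ i → f i + g i)  ≡⟨ ΣQ.∑-distrib-+ f g ⟩
  ΣQ.sum f + ΣQ.sum g       ≡⟨ cong₂ _+_ (sumℚ≡sum f) (sumℚ≡sum g) ⟨
  sumℚ f + sumℚ g           ∎

sumℚ-*ˡ : ∀ {n} (c : ℚ) (f : Fin n → ℚ) → sumℚ (λ i → c * f i) ≡ c * sumℚ f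
sumℚ-*ˡ c f = begin
  sumℚ (λ i → c * f i)    ≡⟨ sumℚ≡sum (λ i → c * f i) ⟩
  ΣQ.sum (λ i → c * f i)  ≡⟨ ΣQ.*-distribˡ-sum c f ⟨
  c * ΣQ.sum f            ≡⟨ cong (c *_) (sumℚ≡sum f) ⟨
  c * sumℚ f              ∎

sumℚ-*ʳ : ∀ {n} (c : ℚ) (f : Fin n → ℚ) → sumℚ (λ i → f i * c) ≡ sumℚ f * c
sumℚ-*ʳ c f = begin
  sumℚ (λ i → f i * c)  ≡⟨ sumℚ-cong (λ i → ℚ.*-comm (f i) c) ⟩
  sumℚ (λ i → c * f i)  ≡⟨ sumℚ-*ˡ c f ⟩
  c * sumℚ f            ≡⟨ ℚ.*-comm c (sumℚ f) ⟩
  sumℚ f * c            ∎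

sumℚ-neg : ∀ {n} (f : Fin n → ℚ) → sumℚ (λ i → - f i) ≡ - sumℚ f
sumℚ-neg {zero} f = refl
sumℚ-neg {suc n} f =
  trans (cong (- f fz +_) (sumℚ-neg (f ∘ fs))) (sym (ℚ.neg-distrib-+ (f fz) _))

sumℚ-distrib-- : ∀ {n} (f g : Fin n → ℚ) → sumℚ (λ i → f i - g i) ≡ sumℚ f - sumℚ g
sumℚ-distrib-- f g = trans (sumℚ-distrib-+ f (λ i → - g i)) (cong (sumℚ f +_) (sumℚ-neg g))

sumℚ-comm : ∀ {m n} (f : Fin m → Fin n → ℚ) →
  sumℚ (λ i → sumℚ (f i)) ≡ sumℚ (λ j → sumℚ (λ i → f i j))
sumℚ-comm f = begin
  sumℚ (λ i → sumℚ (f i))                   ≡⟨ sumℚ-cong (λ i → sumℚ≡sum (f i)) ⟩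
  sumℚ (λ i → ΣQ.sum (f i))                 ≡⟨ sumℚ≡sum (λ i → ΣQ.sum (f i)) ⟩
  ΣQ.sum (λ i → ΣQ.sum (f i))               ≡⟨ ΣQ.∑-comm f ⟩
  ΣQ.sum (λ j → ΣQ.sum (λ i → f i j))       ≡⟨ sumℚ≡sum (λ j → ΣQ.sum (λ i → f i j)) ⟨
  sumℚ (λ j → ΣQ.sum (λ i → f i j))         ≡⟨ sumℚ-cong (λ j → sumℚ≡sum (λ i → f i j)) ⟨
  sumℚ (λ j → sumℚ (λ i → f i j))           ∎

sumℚ-const : ∀ n (c : ℚ) → sumℚ {n} (λ _ → c) ≡ ℕtoℚ n * c
sumℚ-const zero c = sym (ℚ.*-zeroˡ c)
sumℚ-const (suc n) c = begin
  c + sumℚ {n} (λ _ → c)     ≡⟨ cong (c +_) (sumℚ-const n c) ⟩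
  c + ℕtoℚ n * c             ≡⟨ cong (_+ ℕtoℚ n * c) (ℚ.*-identityˡ c) ⟨
  1ℚ * c + ℕtoℚ n * c        ≡⟨ ℚ.*-distribʳ-+ c 1ℚ (ℕtoℚ n) ⟨
  (1ℚ + ℕtoℚ n) * c          ≡⟨ cong (_* c) (ℕtoℚ-homo-+ 1 n) ⟨
  ℕtoℚ (suc n) * c           ∎

sumℚ-δ : ∀ {n} (i : Fin n) (g : Fin n → ℚ) → sumℚ (λ j → δ i j * g j) ≡ g i
sumℚ-δ {suc n} fz g = begin
  1ℚ * g fz + sumℚ (λ j → 0ℚ * g (fs j))
    ≡⟨ cong₂ _+_ (ℚ.*-identityˡ (g fz)) (sumℚ-cong (ℚ.*-zeroˡ ∘ g ∘ fs)) ⟩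
  g fz + sumℚ {n} (λ _ → 0ℚ)
    ≡⟨ cong (g fz +_) (sumℚ-zero n) ⟩
  g fz + 0ℚ
    ≡⟨ ℚ.+-identityʳ (g fz) ⟩
  g fz ∎
sumℚ-δ {suc n} (fs i) g =
  trans (cong₂ _+_ (ℚ.*-zeroˡ (g fz)) (sumℚ-δ i (g ∘ fs))) (ℚ.+-identityˡ (g (fs i)))

sumℚ-splitAt : ∀ m {n} (f : Fin (m +ℕ n) → ℚ) →
  sumℚ f ≡ sumℚ (f ∘ (_↑ˡ n)) + sumℚ (f ∘ (m ↑ʳ_))
sumℚ-splitAt zero f = sym (ℚ.+-identityˡ (sumℚ f))
sumℚ-splitAt (suc m) f =
  trans (cong (f fz +_) (sumℚ-splitAt m (f ∘ fs))) (sym (ℚ.+-assoc (f fz) _ _))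

sumℚ-blocks : ∀ m {n} (f : Fin (m +ℕ n) → Fin (m +ℕ n) → ℚ) → (∀ i j → f i j ≡ f j i) →
  sumℚ (λ i → sumℚ (f i)) ≡
    sumℚ (λ x → sumℚ (λ y → f (x ↑ˡ n) (y ↑ˡ n)))
    + ℕtoℚ 2 * sumℚ (λ x → sumℚ (λ j → f (x ↑ˡ n) (m ↑ʳ j)))
    + sumℚ (λ i → sumℚ (λ j → f (m ↑ʳ i) (m ↑ʳ j)))
sumℚ-blocks m {n} f f-sym = begin
  sumℚ (λ i → sumℚ (f i))
    ≡⟨ sumℚ-cong (λ i → sumℚ-splitAt m (f i)) ⟩
  sumℚ (λ i → sumℚ (λ y → f i (y ↑ˡ n)) + sumℚ (λ j → f i (m ↑ʳ j)))
    ≡⟨ sumℚ-distrib-+ (λ i → sumℚ (λ y → f i (y ↑ˡ n))) (λ i → sumℚ (λ j → f i (m ↑ʳ j))) ⟩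
  sumℚ (λ i → sumℚ (λ y → f i (y ↑ˡ n))) + sumℚ (λ i → sumℚ (λ j → f i (m ↑ʳ j)))
    ≡⟨ cong₂ _+_ (sumℚ-splitAt m (λ i → sumℚ (λ y → f i (y ↑ˡ n))))
                 (sumℚ-splitAt m (λ i → sumℚ (λ j → f i (m ↑ʳ j)))) ⟩
  (Σ₁₁ + sumℚ (λ i → sumℚ (λ y → f (m ↑ʳ i) (y ↑ˡ n)))) + (Σ₁₂ + Σ₂₂)
    ≡⟨ cong (λ z → (Σ₁₁ + z) + (Σ₁₂ + Σ₂₂)) transpose ⟩
  (Σ₁₁ + Σ₁₂) + (Σ₁₂ + Σ₂₂)
    ≡⟨ regroup Σ₁₁ Σ₁₂ Σ₂₂ ⟩
  Σ₁₁ + ℕtoℚ 2 * Σ₁₂ + Σ₂₂ ∎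
  where
  Σ₁₁ = sumℚ (λ x → sumℚ (λ y → f (x ↑ˡ n) (y ↑ˡ n)))
  Σ₁₂ = sumℚ (λ x → sumℚ (λ j → f (x ↑ˡ n) (m ↑ʳ j)))
  Σ₂₂ = sumℚ (λ i → sumℚ (λ j → f (m ↑ʳ i) (m ↑ʳ j)))
  transpose : sumℚ (λ i → sumℚ (λ y → f (m ↑ʳ i) (y ↑ˡ n))) ≡ Σ₁₂
  transpose = trans (sumℚ-comm (λ i y → f (m ↑ʳ i) (y ↑ˡ n)))
                    (sumℚ-cong (λ y → sumℚ-cong (λ i → f-sym (m ↑ʳ i) (y ↑ˡ n))))
  regroup : ∀ a b c → (a + b) + (b + c) ≡ a + ℕtoℚ 2 * b + c
  regroup = solve-∀ ℚ-ring

nonneg-+-≡0 : ∀ {a b} → 0ℚ ≤ℚ a → 0ℚ ≤ℚ b → a + b ≡ 0ℚ → a ≡ 0ℚ × b ≡ 0ℚ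
nonneg-+-≡0 {a} {b} 0≤a 0≤b a+b≡0 = a≡0 , b≡0
  where
  a≡0 : a ≡ 0ℚ
  a≡0 = ℚ.≤-antisym (subst₂ _≤ℚ_ (ℚ.+-identityʳ a) a+b≡0 (ℚ.+-monoʳ-≤ a 0≤b)) 0≤a
  b≡0 : b ≡ 0ℚ
  b≡0 = trans (sym (ℚ.+-identityˡ b)) (trans (cong (_+ b) (sym a≡0)) a+b≡0)

sumℚ-nonneg : ∀ {n} {f : Fin n → ℚ} → (∀ i → 0ℚ ≤ℚ f i) → 0ℚ ≤ℚ sumℚ f
sumℚ-nonneg {zero} _ = ℚ.≤-refl
sumℚ-nonneg {suc n} 0≤f = ℚ.+-mono-≤ (0≤f fz) (sumℚ-nonneg (0≤f ∘ fs))

sumℚ-nonneg-≡0 : ∀ {n} {f : Fin n → ℚ} → (∀ i → 0ℚ ≤ℚ f i) → sumℚ f ≡ 0ℚ → ∀ i → f i ≡ 0ℚ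
sumℚ-nonneg-≡0 {suc n} 0≤f Σf≡0 fz = proj₁ (nonneg-+-≡0 (0≤f fz) (sumℚ-nonneg (0≤f ∘ fs)) Σf≡0)
sumℚ-nonneg-≡0 {suc n} 0≤f Σf≡0 (fs i) =
  sumℚ-nonneg-≡0 (0≤f ∘ fs) (proj₂ (nonneg-+-≡0 (0≤f fz) (sumℚ-nonneg (0≤f ∘ fs)) Σf≡0)) i

sumℕ-δ : ∀ {n} (v : Fin n) → sumℕ (λ j → b2ℕ (does (j ≟ v))) ≡ 1
sumℕ-δ {suc n} fz = cong suc (trans (sumℕ≡sum {n} (λ _ → 0)) (ΣN.sum-replicate-zero n))
sumℕ-δ {suc n} (fs v) = sumℕ-δ v

ℕtoℚ-sumℕ : ∀ {n} (f : Fin n → ℕ) → ℕtoℚ (sumℕ f) ≡ sumℚ (ℕtoℚ ∘ f)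
ℕtoℚ-sumℕ {zero} f = refl
ℕtoℚ-sumℕ {suc n} f = trans (ℕtoℚ-homo-+ (f fz) _) (cong (ℕtoℚ (f fz) +_) (ℕtoℚ-sumℕ (f ∘ fs)))

sumℕ²≡sum² : ∀ {n} (f : Fin n → Fin n → ℕ) →
  sumℕ (λ i → sumℕ (f i)) ≡ ΣN.sum (λ i → ΣN.sum (f i))
sumℕ²≡sum² f = trans (sumℕ≡sum (λ i → sumℕ (f i))) (ΣN.sum-cong-≗ (λ i → sumℕ≡sum (f i)))

dot : ∀ {n} → (Fin n → ℚ) → (Fin n → ℚ) → ℚ
dot f g = sumℚ (λ i → f i * g i)

_·ᵥ_ : ∀ {n} → Matrix n → (Fin n → ℚ) → Fin n → ℚ
(M ·ᵥ p) i = dot (M i) p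

_ᵥ·_ : ∀ {n} → (Fin n → ℚ) → Matrix n → Fin n → ℚ
(p ᵥ· M) j = dot p (λ i → M i j)

IsSymmetric : ∀ {n} → Matrix n → Set
IsSymmetric M = ∀ i j → M i j ≡ M j i

dipole : ∀ {n} → Fin n → Fin n → Fin n → ℚ
dipole s t k = δ s k - δ t k

dot-comm : ∀ {n} (f g : Fin n → ℚ) → dot f g ≡ dot g f
dot-comm f g = sumℚ-cong (λ i → ℚ.*-comm (f i) (g i))

dot-cong : ∀ {n} {f f′ g g′ : Fin n → ℚ} → f ≗ f′ → g ≗ g′ → dot f g ≡ dot f′ g′
dot-cong f≗f′ g≗g′ = sumℚ-cong (λ i → cong₂ _*_ (f≗f′ i) (g≗g′ i))

dot-dipoleʳ : ∀ {n} (g : Fin n → ℚ) (s t : Fin n) → dot g (dipole s t) ≡ g s - g t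
dot-dipoleʳ g s t = begin
  sumℚ (λ k → g k * (δ s k - δ t k))
    ≡⟨ sumℚ-cong (λ k → distrib (g k) (δ s k) (δ t k)) ⟩
  sumℚ (λ k → δ s k * g k - δ t k * g k)
    ≡⟨ sumℚ-distrib-- (λ k → δ s k * g k) (λ k → δ t k * g k) ⟩
  sumℚ (λ k → δ s k * g k) - sumℚ (λ k → δ t k * g k)
    ≡⟨ cong₂ _-_ (sumℚ-δ s g) (sumℚ-δ t g) ⟩
  g s - g t ∎
  where
  distrib : ∀ x a b → x * (a - b) ≡ a * x - b * x
  distrib = solve-∀ ℚ-ring

dot-ᵥ· : ∀ {n} (f : Fin n → ℚ) (M : Matrix n) (g : Fin n → ℚ) → dot (f ᵥ· M) g ≡ dot f (M ·ᵥ g)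
dot-ᵥ· f M g = begin
  sumℚ (λ j → sumℚ (λ i → f i * M i j) * g j)
    ≡⟨ sumℚ-cong (λ j → sumℚ-*ʳ (g j) (λ i → f i * M i j)) ⟨
  sumℚ (λ j → sumℚ (λ i → f i * M i j * g j))
    ≡⟨ sumℚ-comm (λ i j → f i * M i j * g j) ⟨
  sumℚ (λ i → sumℚ (λ j → f i * M i j * g j))
    ≡⟨ sumℚ-cong (λ i → sumℚ-cong (λ j → ℚ.*-assoc (f i) (M i j) (g j))) ⟩
  sumℚ (λ i → sumℚ (λ j → f i * (M i j * g j)))
    ≡⟨ sumℚ-cong (λ i → sumℚ-*ˡ (f i) (λ j → M i j * g j)) ⟩
  sumℚ (λ i → f i * sumℚ (λ j → M i j * g j)) ∎

·-assoc : ∀ {n} (M N K : Matrix n) i j → ((M · N) · K) i j ≡ (M · (N · K)) i j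
·-assoc M N K i j = dot-ᵥ· (M i) N (λ k → K k j)

·ᵥ-assoc : ∀ {n} (M N : Matrix n) (p : Fin n → ℚ) i → ((M · N) ·ᵥ p) i ≡ (M ·ᵥ (N ·ᵥ p)) i
·ᵥ-assoc M N p i = dot-ᵥ· (M i) N p

·ᵥ-cong : ∀ {n} (M : Matrix n) {p q : Fin n → ℚ} → p ≗ q → M ·ᵥ p ≗ M ·ᵥ q
·ᵥ-cong M p≗q i = dot-cong {f′ = M i} (λ _ → refl) p≗q

·ᵥ-distrib-- : ∀ {n} (M : Matrix n) (p q : Fin n → ℚ) i →
  (M ·ᵥ (λ k → p k - q k)) i ≡ (M ·ᵥ p) i - (M ·ᵥ q) i
·ᵥ-distrib-- M p q i =
  trans (sumℚ-cong (λ k → distrib (M i k) (p k) (q k)))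
        (sumℚ-distrib-- (λ k → M i k * p k) (λ k → M i k * q k))
  where
  distrib : ∀ m a b → m * (a - b) ≡ m * a - m * b
  distrib = solve-∀ ℚ-ring

·ᵥ-zeroʳ : ∀ {n} (M : Matrix n) i → (M ·ᵥ (λ _ → 0ℚ)) i ≡ 0ℚ
·ᵥ-zeroʳ {n} M i = trans (sumℚ-cong (λ k → ℚ.*-zeroʳ (M i k))) (sumℚ-zero n)

ᵥ·-symmetric : ∀ {n} {M : Matrix n} → IsSymmetric M → ∀ f → f ᵥ· M ≗ M ·ᵥ f
ᵥ·-symmetric {M = M} M-sym f j = trans (dot-cong {f′ = f} (λ _ → refl) (λ i → M-sym i j)) (dot-comm f (M j))

dot-·ᵥ-symmetric : ∀ {n} {M : Matrix n} → IsSymmetric M → ∀ f g → dot (M ·ᵥ f) g ≡ dot f (M ·ᵥ g)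
dot-·ᵥ-symmetric {M = M} M-sym f g =
  trans (dot-cong {g′ = g} (λ j → sym (ᵥ·-symmetric M-sym f j)) (λ _ → refl)) (dot-ᵥ· f M g)

resistance≡dot : ∀ {n} (Y : Matrix n) s t → resistance Y s t ≡ dot (dipole s t) (Y ·ᵥ dipole s t)
resistance≡dot Y s t = sym (begin
  dot (dipole s t) (Y ·ᵥ dipole s t)
    ≡⟨ dot-comm (dipole s t) _ ⟩
  dot (Y ·ᵥ dipole s t) (dipole s t)
    ≡⟨ dot-dipoleʳ (Y ·ᵥ dipole s t) s t ⟩
  dot (Y s) (dipole s t) - dot (Y t) (dipole s t)
    ≡⟨ cong₂ _-_ (dot-dipoleʳ (Y s) s t) (dot-dipoleʳ (Y t) s t) ⟩
  (Y s s - Y s t) - (Y t s - Y t t)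
    ≡⟨ regroup (Y s s) (Y t t) (Y s t) (Y t s) ⟩
  resistance Y s t ∎)
  where
  regroup : ∀ a b c d → (a - c) - (d - b) ≡ (a + b) - (c + d)
  regroup = solve-∀ ℚ-ring

sumℚ-dipole : ∀ {n} (s t : Fin n) → sumℚ (dipole s t) ≡ 0ℚ
sumℚ-dipole s t = begin
  sumℚ (dipole s t)               ≡⟨ sumℚ-cong (λ k → ℚ.*-identityˡ (dipole s t k)) ⟨
  dot (λ _ → 1ℚ) (dipole s t)     ≡⟨ dot-dipoleʳ (λ _ → 1ℚ) s t ⟩
  1ℚ - 1ℚ                         ≡⟨⟩
  0ℚ                              ∎

Loopless : ∀ {n} → Adj n → Set
Loopless A = ∀ i → A i i ≡ false

IsHarmonic : ∀ {n} → Matrix n → (Fin n → ℚ) → Set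
IsHarmonic M w = ∀ i → (M ·ᵥ w) i ≡ 0ℚ

laplacian-entry : ∀ {n} {A : Adj n} → Loopless A → ∀ i j →
  laplacian A i j ≡ δ i j * ℕtoℚ (degree A i) - b2ℚ (A i j)
laplacian-entry {A = A} loopless i j with i ≟ j
... | yes refl rewrite loopless i =
  sym (trans (ℚ.+-identityʳ _) (ℚ.*-identityˡ (ℕtoℚ (degree A i))))
... | no _ with A i j
...   | true = sym (trans (cong (_- 1ℚ) (ℚ.*-zeroˡ (ℕtoℚ (degree A i)))) (ℚ.+-identityˡ _))
...   | false = sym (trans (ℚ.+-identityʳ _) (ℚ.*-zeroˡ (ℕtoℚ (degree A i))))

laplacian-symmetric : ∀ {n} {A : Adj n} → IsSimple A → IsSymmetric (laplacian A)
laplacian-symmetric {A = A} (_ , A-sym) i j with i ≟ j | j ≟ i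
... | yes refl | yes _    = refl
... | yes refl | no i≢i   = ⊥-elim (i≢i refl)
... | no i≢i   | yes refl = ⊥-elim (i≢i refl)
... | no _     | no _     rewrite A-sym i j = refl

laplacian-·ᵥ : ∀ {n} {A : Adj n} → Loopless A → ∀ p i →
  (laplacian A ·ᵥ p) i ≡ sumℚ (λ j → b2ℚ (A i j) * (p i - p j))
laplacian-·ᵥ {A = A} loopless p i = begin
  sumℚ (λ j → laplacian A i j * p j)
    ≡⟨ sumℚ-cong (λ j → trans (cong (_* p j) (laplacian-entry loopless i j))
                              (expand (δ i j) d (b j) (p j))) ⟩
  sumℚ (λ j → δ i j * (d * p j) - b j * p j)
    ≡⟨ sumℚ-distrib-- (λ j → δ i j * (d * p j)) (λ j → b j * p j) ⟩
  sumℚ (λ j → δ i j * (d * p j)) - sumℚ (λ j → b j * p j)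
    ≡⟨ cong (_- sumℚ (λ j → b j * p j)) (sumℚ-δ i (λ j → d * p j)) ⟩
  d * p i - sumℚ (λ j → b j * p j)
    ≡⟨ cong (λ x → x * p i - sumℚ (λ j → b j * p j)) (ℕtoℚ-sumℕ (λ j → b2ℕ (A i j))) ⟩
  sumℚ b * p i - sumℚ (λ j → b j * p j)
    ≡⟨ cong (_- sumℚ (λ j → b j * p j)) (sumℚ-*ʳ (p i) b) ⟨
  sumℚ (λ j → b j * p i) - sumℚ (λ j → b j * p j)
    ≡⟨ sumℚ-distrib-- (λ j → b j * p i) (λ j → b j * p j) ⟨
  sumℚ (λ j → b j * p i - b j * p j)
    ≡⟨ sumℚ-cong (λ j → factor (b j) (p i) (p j)) ⟩
  sumℚ (λ j → b j * (p i - p j))  ∎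
  where
  d = ℕtoℚ (degree A i)
  b = λ j → b2ℚ (A i j)
  expand : ∀ e d b x → (e * d - b) * x ≡ e * (d * x) - b * x
  expand = solve-∀ ℚ-ring
  factor : ∀ b x y → b * x - b * y ≡ b * (x - y)
  factor = solve-∀ ℚ-ring

laplacian-·ᵥ-const : ∀ {n} {A : Adj n} → Loopless A → ∀ c → IsHarmonic (laplacian A) (λ _ → c)
laplacian-·ᵥ-const {n} {A} loopless c i = begin
  (laplacian A ·ᵥ (λ _ → c)) i
    ≡⟨ laplacian-·ᵥ loopless (λ _ → c) i ⟩
  sumℚ (λ j → b2ℚ (A i j) * (c - c))
    ≡⟨ sumℚ-cong (λ j → trans (cong (b2ℚ (A i j) *_) (ℚ.+-inverseʳ c)) (ℚ.*-zeroʳ (b2ℚ (A i j)))) ⟩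
  sumℚ {n} (λ _ → 0ℚ)
    ≡⟨ sumℚ-zero n ⟩
  0ℚ ∎

sumℚ-laplacian-·ᵥ : ∀ {n} {A : Adj n} → IsSimple A → ∀ p → sumℚ (laplacian A ·ᵥ p) ≡ 0ℚ
sumℚ-laplacian-·ᵥ {n} {A} simple p = begin
  sumℚ (laplacian A ·ᵥ p)
    ≡⟨ sumℚ-cong (λ i → ℚ.*-identityˡ ((laplacian A ·ᵥ p) i)) ⟨
  dot (λ _ → 1ℚ) (laplacian A ·ᵥ p)
    ≡⟨ dot-·ᵥ-symmetric (laplacian-symmetric simple) (λ _ → 1ℚ) p ⟨
  dot (laplacian A ·ᵥ (λ _ → 1ℚ)) p
    ≡⟨ dot-cong {g′ = p} (laplacian-·ᵥ-const (proj₁ simple) 1ℚ) (λ _ → refl) ⟩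
  sumℚ (λ i → 0ℚ * p i)
    ≡⟨ sumℚ-cong (ℚ.*-zeroˡ ∘ p) ⟩
  sumℚ {n} (λ _ → 0ℚ)
    ≡⟨ sumℚ-zero n ⟩
  0ℚ ∎

adjacency-split : ∀ {n} {A : Adj n} → IsSimple A → ∀ i j →
  b2ℕ (A i j) ≡ b2ℕ (does (i <? j) ∧ A i j) +ℕ b2ℕ (does (j <? i) ∧ A j i)
adjacency-split {A = A} (loopless , A-sym) i j with Finₚ.<-cmp i j
... | tri< i<j _ j≮i rewrite dec-true (i <? j) i<j | dec-false (j <? i) j≮i = sym (ℕ.+-identityʳ _)
... | tri> i≮j _ j<i rewrite dec-false (i <? j) i≮j | dec-true (j <? i) j<i | A-sym i j = refl
... | tri≈ _ refl _ rewrite dec-false (i <? i) (Finₚ.<-irrefl refl) | loopless i = refl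

handshake : ∀ {n} {A : Adj n} → IsSimple A → sumℕ (degree A) ≡ 2 *ℕ edgeCount A
handshake {n} {A} simple = begin
  sumℕ (degree A)
    ≡⟨ sumℕ²≡sum² (λ i j → b2ℕ (A i j)) ⟩
  ΣN.sum (λ i → ΣN.sum (λ j → b2ℕ (A i j)))
    ≡⟨ ΣN.sum-cong-≗ (λ i → ΣN.sum-cong-≗ (adjacency-split simple i)) ⟩
  ΣN.sum (λ i → ΣN.sum (λ j → E i j +ℕ E j i))
    ≡⟨ ΣN.sum-cong-≗ (λ i → ΣN.∑-distrib-+ (E i) (λ j → E j i)) ⟩
  ΣN.sum (λ i → ΣN.sum (E i) +ℕ ΣN.sum (λ j → E j i))
    ≡⟨ ΣN.∑-distrib-+ (λ i → ΣN.sum (E i)) (λ i → ΣN.sum (λ j → E j i)) ⟩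
  e +ℕ ΣN.sum (λ i → ΣN.sum (λ j → E j i))
    ≡⟨ cong (e +ℕ_) (ΣN.∑-comm (λ i j → E j i)) ⟩
  e +ℕ e
    ≡⟨ cong (e +ℕ_) (ℕ.+-identityʳ e) ⟨
  2 *ℕ e
    ≡⟨ cong (2 *ℕ_) (sumℕ²≡sum² E) ⟨
  2 *ℕ edgeCount A ∎
  where
  E : Fin n → Fin n → ℕ
  E i j = b2ℕ (does (i <? j) ∧ A i j)
  e = ΣN.sum (λ i → ΣN.sum (E i))

sumℚ-degree : ∀ {n} {A : Adj n} → IsSimple A → sumℚ (ℕtoℚ ∘ degree A) ≡ ℕtoℚ 2 * ℕtoℚ (edgeCount A)
sumℚ-degree {A = A} simple =
  trans (sym (ℕtoℚ-sumℕ (degree A))) (trans (cong ℕtoℚ (handshake simple)) (ℕtoℚ-homo-* 2 (edgeCount A)))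

-- Harmonic functions on a connected graph are constant

harmonic-max-neighbour : ∀ {n} {A : Adj n} {w : Fin n → ℚ} {i k} → Loopless A →
  (laplacian A ·ᵥ w) i ≡ 0ℚ → (∀ j → w j ≤ℚ w i) → A i k ≡ true → w k ≡ w i
harmonic-max-neighbour {A = A} {w} {i} {k} loopless harmonic-at-i w≤wi Aik =
  sym (ℚ-Group.x∙y⁻¹≈ε⇒x≈y (w i) (w k) (trans (sym (ℚ.*-identityˡ (w i - w k))) term-k≡0))
  where
  term≥0 : ∀ j → 0ℚ ≤ℚ b2ℚ (A i j) * (w i - w j)
  term≥0 j with A i j
  ... | true  = subst (0ℚ ≤ℚ_) (sym (ℚ.*-identityˡ (w i - w j)))
                  (subst (_≤ℚ w i - w j) (ℚ.+-inverseʳ (w j)) (ℚ.+-monoˡ-≤ (- w j) (w≤wi j)))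
  ... | false = subst (0ℚ ≤ℚ_) (sym (ℚ.*-zeroˡ (w i - w j))) ℚ.≤-refl
  term-k≡0 : b2ℚ true * (w i - w k) ≡ 0ℚ
  term-k≡0 = subst (λ b → b2ℚ b * (w i - w k) ≡ 0ℚ) Aik
    (sumℚ-nonneg-≡0 term≥0 (trans (sym (laplacian-·ᵥ loopless w i)) harmonic-at-i) k)

harmonic-max-reach : ∀ {n} {A : Adj n} {w : Fin n → ℚ} {i j} → Loopless A →
  IsHarmonic (laplacian A) w → (∀ l → w l ≤ℚ w i) → Reach A i j → w j ≡ w i
harmonic-max-reach loopless harmonic w≤wi here = refl
harmonic-max-reach {w = w} {i} loopless harmonic w≤wi (step {k = k} Aik k⇝j) =
  trans (harmonic-max-reach loopless harmonic (λ l → subst (w l ≤ℚ_) (sym wk≡wi) (w≤wi l)) k⇝j) wk≡wi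
  where
  wk≡wi : w k ≡ w i
  wk≡wi = harmonic-max-neighbour loopless (harmonic i) w≤wi Aik

harmonic-constant : ∀ {n} {A : Adj n} {w : Fin n → ℚ} → Loopless A → IsConnected A →
  IsHarmonic (laplacian A) w → ∀ i j → w i ≡ w j
harmonic-constant {n} {A} {w} loopless connected harmonic i j = trans (≡max i) (sym (≡max j))
  where
  top : Fin n
  top = ℚ-Extrema.argmax w i (allFin n)
  w≤top : ∀ l → w l ≤ℚ w top
  w≤top l = All.lookup (ℚ-Extrema.f[xs]≤f[argmax] i (allFin n)) (∈-allFin l)
  ≡max : ∀ l → w l ≡ w top
  ≡max l = harmonic-max-reach loopless harmonic w≤top (connected top l)

harmonic-sum-zero : ∀ {n} {A : Adj n} {w : Fin n → ℚ} → Loopless A → IsConnected A →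
  IsHarmonic (laplacian A) w → sumℚ w ≡ 0ℚ → ∀ i → w i ≡ 0ℚ
harmonic-sum-zero {suc n} {w = w} loopless connected harmonic Σw≡0 i = suc*x≡0⇒x≡0 n (begin
  ℕtoℚ (suc n) * w i          ≡⟨ sumℚ-const (suc n) (w i) ⟨
  sumℚ {suc n} (λ _ → w i)    ≡⟨ sumℚ-cong (λ j → harmonic-constant {w = w} loopless connected harmonic i j) ⟩
  sumℚ w                      ≡⟨ Σw≡0 ⟩
  0ℚ                          ∎)

-- Potentials and effective resistance

resistance-sym : ∀ {n} (Y : Matrix n) i j → resistance Y i j ≡ resistance Y j i
resistance-sym Y i j = swap (Y i i) (Y j j) (Y i j) (Y j i)
  where
  swap : ∀ a b c d → (a + b) - (c + d) ≡ (b + a) - (d + c)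
  swap = solve-∀ ℚ-ring

resistance-self : ∀ {n} (Y : Matrix n) i → resistance Y i i ≡ 0ℚ
resistance-self Y i = cancel (Y i i)
  where
  cancel : ∀ a → (a + a) - (a + a) ≡ 0ℚ
  cancel = solve-∀ ℚ-ring

IsPotential : ∀ {n} → Matrix n → Fin n → Fin n → (Fin n → ℚ) → Set
IsPotential M s t p = M ·ᵥ p ≗ dipole s t

resistance-potential : ∀ {n} {M Y : Matrix n} {s t p} → IsSymmetric M →
  (∀ i j → (M · (Y · M)) i j ≡ M i j) → IsPotential M s t p → resistance Y s t ≡ p s - p t
resistance-potential {M = M} {Y} {s} {t} {p} M-sym MYM≡M potential = begin
  resistance Y s t
    ≡⟨ resistance≡dot Y s t ⟩
  dot f (Y ·ᵥ f)
    ≡⟨ dot-cong (sym ∘ potential) (·ᵥ-cong Y (sym ∘ potential)) ⟩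
  dot (M ·ᵥ p) (Y ·ᵥ (M ·ᵥ p))
    ≡⟨ dot-·ᵥ-symmetric M-sym p (Y ·ᵥ (M ·ᵥ p)) ⟩
  dot p (M ·ᵥ (Y ·ᵥ (M ·ᵥ p)))
    ≡⟨ dot-cong {f′ = p} (λ _ → refl) reassociate ⟩
  dot p ((M · (Y · M)) ·ᵥ p)
    ≡⟨ dot-cong {f′ = p} (λ _ → refl) (λ i → dot-cong {g′ = p} (MYM≡M i) (λ _ → refl)) ⟩
  dot p (M ·ᵥ p)
    ≡⟨ dot-cong {f′ = p} (λ _ → refl) potential ⟩
  dot p f
    ≡⟨ dot-dipoleʳ p s t ⟩
  p s - p t ∎
  where
  f = dipole s t
  reassociate : M ·ᵥ (Y ·ᵥ (M ·ᵥ p)) ≗ (M · (Y · M)) ·ᵥ p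
  reassociate i = trans (·ᵥ-cong M (λ a → sym (·ᵥ-assoc Y M p a)) i) (sym (·ᵥ-assoc M (Y · M) p i))

pseudoinverse-absorb : ∀ {n} {M X : Matrix n} → IsSymmetric M → IsPseudoInverse M X →
  ∀ i j → (M · (M · X)) i j ≡ M i j
pseudoinverse-absorb {M = M} {X} M-sym (MXM≡M , _ , MX-sym , _) i j = begin
  sumℚ (λ k → M i k * (M · X) k j)
    ≡⟨ sumℚ-cong (λ k → trans (ℚ.*-comm (M i k) _) (cong₂ _*_ (MX-sym k j) (M-sym i k))) ⟩
  ((M · X) · M) j i
    ≡⟨ ·-assoc M X M j i ⟩
  (M · (X · M)) j i
    ≡⟨ MXM≡M j i ⟩
  M j i
    ≡⟨ M-sym j i ⟩
  M i j ∎

laplacian-pseudoinverse-solves : ∀ {n} {A : Adj n} {X : Matrix n} → IsSimple A → IsConnected A →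
  IsPseudoInverse (laplacian A) X → ∀ f → sumℚ f ≡ 0ℚ → laplacian A ·ᵥ (X ·ᵥ f) ≗ f
laplacian-pseudoinverse-solves {A = A} {X} simple connected pinv f Σf≡0 i =
  sym (ℚ-Group.x∙y⁻¹≈ε⇒x≈y (f i) (u i) (harmonic-sum-zero (proj₁ simple) connected harmonic Σw≡0 i))
  where
  L = laplacian A
  u = L ·ᵥ (X ·ᵥ f)
  w = λ k → f k - u k
  Lu≗Lf : L ·ᵥ u ≗ L ·ᵥ f
  Lu≗Lf k = begin
    (L ·ᵥ (L ·ᵥ (X ·ᵥ f))) k
      ≡⟨ ·ᵥ-cong L (λ a → sym (·ᵥ-assoc L X f a)) k ⟩
    (L ·ᵥ ((L · X) ·ᵥ f)) k
      ≡⟨ ·ᵥ-assoc L (L · X) f k ⟨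
    ((L · (L · X)) ·ᵥ f) k
      ≡⟨ dot-cong {g′ = f} (pseudoinverse-absorb (laplacian-symmetric simple) pinv k) (λ _ → refl) ⟩
    (L ·ᵥ f) k ∎
  harmonic : IsHarmonic L w
  harmonic k = trans (·ᵥ-distrib-- L f u k)
                     (trans (cong (λ x → (L ·ᵥ f) k - x) (Lu≗Lf k)) (ℚ.+-inverseʳ ((L ·ᵥ f) k)))
  Σw≡0 : sumℚ w ≡ 0ℚ
  Σw≡0 = trans (sumℚ-distrib-- f u) (cong₂ _-_ Σf≡0 (sumℚ-laplacian-·ᵥ simple (X ·ᵥ f)))

pseudoinverse-potential : ∀ {n} {A : Adj n} {X : Matrix n} → IsSimple A → IsConnected A →
  IsPseudoInverse (laplacian A) X → ∀ s t → IsPotential (laplacian A) s t (X ·ᵥ dipole s t)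
pseudoinverse-potential simple connected pinv s t =
  laplacian-pseudoinverse-solves simple connected pinv (dipole s t) (sumℚ-dipole s t)

degreeKirchhoff : ∀ {n} → Adj n → Matrix n → ℚ
degreeKirchhoff A X =
  sumℚ (λ i → sumℚ (λ j → ℕtoℚ (degree A i) * ℕtoℚ (degree A j) * resistance X i j))

moment-swap : ∀ {n} (A : Adj n) (X : Matrix n) v →
  moment A X v ≡ sumℚ (λ j → ℕtoℚ (degree A j) * resistance X v j)
moment-swap A X v = sumℚ-cong (λ j → cong (ℕtoℚ (degree A j) *_) (resistance-sym X j v))

-- The gadget

path₃ : Adj 3
path₃ fz (fs fz) = true
path₃ (fs fz) fz = true
path₃ (fs fz) (fs (fs fz)) = true
path₃ (fs (fs fz)) (fs fz) = true
path₃ _ _ = false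

path₃-loopless : Loopless path₃
path₃-loopless fz = refl
path₃-loopless (fs fz) = refl
path₃-loopless (fs (fs fz)) = refl

-- Each gadget vertex has exactly one edge to v; grounding v adds the identity to the Laplacian of a - b - c.
groundedGadget : Matrix 3
groundedGadget x y = laplacian path₃ x y + δ x y

groundedGadget-·ᵥ : ∀ g y → (groundedGadget ·ᵥ g) y ≡ (laplacian path₃ ·ᵥ g) y + g y
groundedGadget-·ᵥ g y = begin
  sumℚ (λ x → (laplacian path₃ y x + δ y x) * g x)
    ≡⟨ sumℚ-cong (λ x → ℚ.*-distribʳ-+ (g x) (laplacian path₃ y x) (δ y x)) ⟩
  sumℚ (λ x → laplacian path₃ y x * g x + δ y x * g x)
    ≡⟨ sumℚ-distrib-+ (λ x → laplacian path₃ y x * g x) (λ x → δ y x * g x) ⟩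
  (laplacian path₃ ·ᵥ g) y + sumℚ (λ x → δ y x * g x)
    ≡⟨ cong ((laplacian path₃ ·ᵥ g) y +_) (sumℚ-δ y g) ⟩
  (laplacian path₃ ·ᵥ g) y + g y  ∎

-- The inverse of groundedGadget: row x is the gadget potential when a unit current enters at x
-- and leaves through the grounded v.
gadgetGreen : Matrix 3
gadgetGreen x y = ℤ.+ Vec.lookup (Vec.lookup entries x) y / 8
  where
  entries = (5 ∷ 2 ∷ 1 ∷ []) ∷ (2 ∷ 4 ∷ 2 ∷ []) ∷ (1 ∷ 2 ∷ 5 ∷ []) ∷ []

gadgetGreen-inverse : ∀ x y → (groundedGadget ·ᵥ gadgetGreen x) y ≡ δ x y
gadgetGreen-inverse =
  toWitness {a? = Finₚ.all? λ x → Finₚ.all? λ y → (groundedGadget ·ᵥ gadgetGreen x) y ℚ.≟ δ x y} _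

sumℚ-gadgetGreen : ∀ x → sumℚ (gadgetGreen x) ≡ 1ℚ
sumℚ-gadgetGreen = toWitness {a? = Finₚ.all? λ x → sumℚ (gadgetGreen x) ℚ.≟ 1ℚ} _

gadget-degreeKirchhoff :
  sumℚ (λ x → sumℚ (λ y →
    ℕtoℚ (suc (degree path₃ x)) * ℕtoℚ (suc (degree path₃ y)) * resistance gadgetGreen x y))
  ≡ ℕtoℚ 23
gadget-degreeKirchhoff = refl

gadget-cross-weights : ∀ M μ →
  sumℚ (λ x → ℕtoℚ (suc (degree path₃ x)) * (gadgetGreen x x * M + μ)) ≡ ℕtoℚ 4 * M + ℕtoℚ 7 * μ
gadget-cross-weights M μ = begin
  sumℚ (λ x → d x * (gadgetGreen x x * M + μ))
    ≡⟨ sumℚ-cong (λ x → distrib (d x) (gadgetGreen x x) M μ) ⟩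
  sumℚ (λ x → d x * gadgetGreen x x * M + d x * μ)
    ≡⟨ sumℚ-distrib-+ (λ x → d x * gadgetGreen x x * M) (λ x → d x * μ) ⟩
  sumℚ (λ x → d x * gadgetGreen x x * M) + sumℚ (λ x → d x * μ)
    ≡⟨ cong₂ _+_ (sumℚ-*ʳ M (λ x → d x * gadgetGreen x x)) (sumℚ-*ʳ μ d) ⟩
  ℕtoℚ 4 * M + ℕtoℚ 7 * μ  ∎
  where
  d : Fin 3 → ℚ
  d x = ℕtoℚ (suc (degree path₃ x))
  distrib : ∀ d g M μ → d * (g * M + μ) ≡ d * g * M + d * μ
  distrib = solve-∀ ℚ-ring

-- The graph hat A v

module Hat {n} (A : Adj n) (v : Fin n) where

  Â : Adj (3 +ℕ n)
  Â = hat A v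

  G : Fin n → Fin (3 +ℕ n)
  G i = 3 ↑ʳ i

  hat-loopless : Loopless A → Loopless Â
  hat-loopless loopless fz = refl
  hat-loopless loopless (fs fz) = refl
  hat-loopless loopless (fs (fs fz)) = refl
  hat-loopless loopless (fs (fs (fs i))) = loopless i

  hat-simple : IsSimple A → IsSimple Â
  hat-simple (loopless , A-sym) = hat-loopless loopless , hat-sym
    where
    hat-sym : ∀ i j → Â i j ≡ Â j i
    hat-sym fz fz = refl
    hat-sym fz (fs fz) = refl
    hat-sym fz (fs (fs fz)) = refl
    hat-sym fz (fs (fs (fs j))) = refl
    hat-sym (fs fz) fz = refl
    hat-sym (fs fz) (fs fz) = refl
    hat-sym (fs fz) (fs (fs fz)) = refl
    hat-sym (fs fz) (fs (fs (fs j))) = refl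
    hat-sym (fs (fs fz)) fz = refl
    hat-sym (fs (fs fz)) (fs fz) = refl
    hat-sym (fs (fs fz)) (fs (fs fz)) = refl
    hat-sym (fs (fs fz)) (fs (fs (fs j))) = refl
    hat-sym (fs (fs (fs i))) fz = refl
    hat-sym (fs (fs (fs i))) (fs fz) = refl
    hat-sym (fs (fs (fs i))) (fs (fs fz)) = refl
    hat-sym (fs (fs (fs i))) (fs (fs (fs j))) = A-sym i j

  hat-gadget : ∀ x y → Â (x ↑ˡ n) (y ↑ˡ n) ≡ path₃ x y
  hat-gadget fz fz = refl
  hat-gadget fz (fs fz) = refl
  hat-gadget fz (fs (fs fz)) = refl
  hat-gadget (fs fz) fz = refl
  hat-gadget (fs fz) (fs fz) = refl
  hat-gadget (fs fz) (fs (fs fz)) = refl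
  hat-gadget (fs (fs fz)) fz = refl
  hat-gadget (fs (fs fz)) (fs fz) = refl
  hat-gadget (fs (fs fz)) (fs (fs fz)) = refl

  hat-gadget-G : ∀ x j → Â (x ↑ˡ n) (G j) ≡ does (j ≟ v)
  hat-gadget-G fz j = refl
  hat-gadget-G (fs fz) j = refl
  hat-gadget-G (fs (fs fz)) j = refl

  hat-G-gadget : ∀ i x → Â (G i) (x ↑ˡ n) ≡ does (i ≟ v)
  hat-G-gadget i fz = refl
  hat-G-gadget i (fs fz) = refl
  hat-G-gadget i (fs (fs fz)) = refl

  edgeCount-hat : edgeCount Â ≡ 5 +ℕ edgeCount A
  edgeCount-hat = cong (λ S → suc S +ℕ (suc S +ℕ (S +ℕ edgeCount A))) (sumℕ-δ v)

  degree-hat-gadget : ∀ x → degree Â (x ↑ˡ n) ≡ suc (degree path₃ x)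
  degree-hat-gadget fz = cong suc (sumℕ-δ v)
  degree-hat-gadget (fs fz) = cong (suc ∘ suc) (sumℕ-δ v)
  degree-hat-gadget (fs (fs fz)) = cong suc (sumℕ-δ v)

  degree-hat-G : ∀ i → ℕtoℚ (degree Â (G i)) ≡ ℕtoℚ (degree A i) + ℕtoℚ 3 * δ i v
  degree-hat-G i = begin
    ℕtoℚ (b +ℕ (b +ℕ (b +ℕ degree A i)))
      ≡⟨ trans (ℕtoℚ-homo-+ b _)
               (cong (ℕtoℚ b +_) (trans (ℕtoℚ-homo-+ b _) (cong (ℕtoℚ b +_) (ℕtoℚ-homo-+ b _)))) ⟩
    δ i v + (δ i v + (δ i v + ℕtoℚ (degree A i)))
      ≡⟨ collect (δ i v) (ℕtoℚ (degree A i)) ⟩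
    ℕtoℚ (degree A i) + ℕtoℚ 3 * δ i v ∎
    where
    b = b2ℕ (does (i ≟ v))
    collect : ∀ e d → e + (e + (e + d)) ≡ d + ℕtoℚ 3 * e
    collect = solve-∀ ℚ-ring

  laplacian-hat-gadget-row : Loopless A → ∀ q y → (laplacian Â ·ᵥ q) (y ↑ˡ n) ≡
    sumℚ (λ x → b2ℚ (path₃ y x) * (q (y ↑ˡ n) - q (x ↑ˡ n))) + (q (y ↑ˡ n) - q (G v))
  laplacian-hat-gadget-row loopless q y = begin
    (laplacian Â ·ᵥ q) (y ↑ˡ n)
      ≡⟨ laplacian-·ᵥ {A = Â} (hat-loopless loopless) q (y ↑ˡ n) ⟩
    sumℚ (λ k → b2ℚ (Â (y ↑ˡ n) k) * (q (y ↑ˡ n) - q k))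
      ≡⟨ sumℚ-splitAt 3 (λ k → b2ℚ (Â (y ↑ˡ n) k) * (q (y ↑ˡ n) - q k)) ⟩
    sumℚ (λ x → b2ℚ (Â (y ↑ˡ n) (x ↑ˡ n)) * (q (y ↑ˡ n) - q (x ↑ˡ n)))
      + sumℚ (λ j → b2ℚ (Â (y ↑ˡ n) (G j)) * (q (y ↑ˡ n) - q (G j)))
      ≡⟨ cong₂ _+_ (sumℚ-cong (λ x → cong (λ b → b2ℚ b * (q (y ↑ˡ n) - q (x ↑ˡ n))) (hat-gadget y x)))
                   (sumℚ-cong (λ j → cong (λ b → b2ℚ b * (q (y ↑ˡ n) - q (G j))) (hat-gadget-G y j))) ⟩
    sumℚ (λ x → b2ℚ (path₃ y x) * (q (y ↑ˡ n) - q (x ↑ˡ n)))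
      + sumℚ (λ j → δ j v * (q (y ↑ˡ n) - q (G j)))
      ≡⟨ cong (sumℚ (λ x → b2ℚ (path₃ y x) * (q (y ↑ˡ n) - q (x ↑ˡ n))) +_)
              (trans (sumℚ-cong (λ j → cong (_* (q (y ↑ˡ n) - q (G j))) (δ-sym j v)))
                     (sumℚ-δ v (λ j → q (y ↑ˡ n) - q (G j)))) ⟩
    sumℚ (λ x → b2ℚ (path₃ y x) * (q (y ↑ˡ n) - q (x ↑ˡ n))) + (q (y ↑ˡ n) - q (G v))  ∎

  laplacian-hat-G-row : Loopless A → ∀ q i → (laplacian Â ·ᵥ q) (G i) ≡
    δ i v * sumℚ (λ x → q (G i) - q (x ↑ˡ n)) + (laplacian A ·ᵥ (q ∘ G)) i
  laplacian-hat-G-row loopless q i = begin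
    (laplacian Â ·ᵥ q) (G i)
      ≡⟨ laplacian-·ᵥ {A = Â} (hat-loopless loopless) q (G i) ⟩
    sumℚ (λ k → b2ℚ (Â (G i) k) * (q (G i) - q k))
      ≡⟨ sumℚ-splitAt 3 (λ k → b2ℚ (Â (G i) k) * (q (G i) - q k)) ⟩
    sumℚ (λ x → b2ℚ (Â (G i) (x ↑ˡ n)) * (q (G i) - q (x ↑ˡ n)))
      + sumℚ (λ j → b2ℚ (A i j) * (q (G i) - q (G j)))
      ≡⟨ cong₂ _+_ (trans (sumℚ-cong (λ x → cong (λ b → b2ℚ b * (q (G i) - q (x ↑ˡ n))) (hat-G-gadget i x)))
                          (sumℚ-*ˡ (δ i v) (λ x → q (G i) - q (x ↑ˡ n))))
                   (sym (laplacian-·ᵥ {A = A} loopless (q ∘ G) i)) ⟩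
    δ i v * sumℚ (λ x → q (G i) - q (x ↑ˡ n)) + (laplacian A ·ᵥ (q ∘ G)) i  ∎

  lift : (Fin 3 → ℚ) → (Fin n → ℚ) → Fin (3 +ℕ n) → ℚ
  lift g p = (λ x → p v + g x) ++ p

  liftCurrent : (Fin 3 → ℚ) → (Fin n → ℚ) → Fin (3 +ℕ n) → ℚ
  liftCurrent g p = (groundedGadget ·ᵥ g) ++ (λ i → (laplacian A ·ᵥ p) i - δ i v * sumℚ g)

  laplacian-hat-lift : Loopless A → ∀ g p → laplacian Â ·ᵥ lift g p ≗ liftCurrent g p
  laplacian-hat-lift loopless g p = splitAt-≗ 3 gadget-row G-row
    where
    q = lift g p
    q-gadget : ∀ x → q (x ↑ˡ n) ≡ p v + g x
    q-gadget = lookup-++ˡ (λ x → p v + g x) p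
    cancelˡ : ∀ a b c → (a + b) - (a + c) ≡ b - c
    cancelˡ = solve-∀ ℚ-ring
    cancel : ∀ a b → (a + b) - a ≡ b
    cancel = solve-∀ ℚ-ring
    gadget-row : ∀ y → (laplacian Â ·ᵥ q) (y ↑ˡ n) ≡ liftCurrent g p (y ↑ˡ n)
    gadget-row y = begin
      (laplacian Â ·ᵥ q) (y ↑ˡ n)
        ≡⟨ laplacian-hat-gadget-row loopless q y ⟩
      sumℚ (λ x → b2ℚ (path₃ y x) * (q (y ↑ˡ n) - q (x ↑ˡ n))) + (q (y ↑ˡ n) - p v)
        ≡⟨ cong₂ _+_ (sumℚ-cong (λ x → cong (b2ℚ (path₃ y x) *_)
                        (trans (cong₂ _-_ (q-gadget y) (q-gadget x)) (cancelˡ (p v) (g y) (g x)))))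
                     (trans (cong (_- p v) (q-gadget y)) (cancel (p v) (g y))) ⟩
      sumℚ (λ x → b2ℚ (path₃ y x) * (g y - g x)) + g y
        ≡⟨ cong (_+ g y) (laplacian-·ᵥ {A = path₃} path₃-loopless g y) ⟨
      (laplacian path₃ ·ᵥ g) y + g y
        ≡⟨ groundedGadget-·ᵥ g y ⟨
      (groundedGadget ·ᵥ g) y
        ≡⟨ lookup-++ˡ (groundedGadget ·ᵥ g) _ y ⟨
      liftCurrent g p (y ↑ˡ n)  ∎
    G-row : ∀ i → (laplacian Â ·ᵥ q) (G i) ≡ (laplacian A ·ᵥ p) i - δ i v * sumℚ g
    G-row i = begin
      (laplacian Â ·ᵥ q) (G i)
        ≡⟨ laplacian-hat-G-row loopless q i ⟩
      δ i v * sumℚ (λ x → p i - q (x ↑ˡ n)) + (laplacian A ·ᵥ p) i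
        ≡⟨ cong (λ z → δ i v * z + (laplacian A ·ᵥ p) i)
                (sumℚ-cong (λ x → cong (λ z → p i - z) (q-gadget x))) ⟩
      δ i v * sumℚ (λ x → p i - (p v + g x)) + (laplacian A ·ᵥ p) i
        ≡⟨ cong (_+ (laplacian A ·ᵥ p) i) (δ-*-transport i v (λ k → sumℚ (λ x → p k - (p v + g x)))) ⟩
      δ i v * sumℚ (λ x → p v - (p v + g x)) + (laplacian A ·ᵥ p) i
        ≡⟨ cong (λ z → δ i v * z + (laplacian A ·ᵥ p) i)
                (trans (sumℚ-cong (λ x → drop (p v) (g x))) (sumℚ-neg g)) ⟩
      δ i v * - sumℚ g + (laplacian A ·ᵥ p) i
        ≡⟨ rearrange (δ i v) (sumℚ g) ((laplacian A ·ᵥ p) i) ⟩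
      (laplacian A ·ᵥ p) i - δ i v * sumℚ g ∎
      where
      drop : ∀ a b → a - (a + b) ≡ - b
      drop = solve-∀ ℚ-ring
      rearrange : ∀ d s l → d * - s + l ≡ l - d * s
      rearrange = solve-∀ ℚ-ring

  hat-potential-G : Loopless A → ∀ {s t p} → IsPotential (laplacian A) s t p →
    IsPotential (laplacian Â) (G s) (G t) (lift (λ _ → 0ℚ) p)
  hat-potential-G loopless {s} {t} {p} potential k =
    trans (laplacian-hat-lift loopless (λ _ → 0ℚ) p k)
          (splitAt-≗ 3 {f = liftCurrent (λ _ → 0ℚ) p} on-gadget on-G k)
    where
    on-gadget : ∀ y → liftCurrent (λ _ → 0ℚ) p (y ↑ˡ n) ≡ dipole (G s) (G t) (y ↑ˡ n)
    on-gadget y = begin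
      liftCurrent (λ _ → 0ℚ) p (y ↑ˡ n)              ≡⟨ lookup-++ˡ (groundedGadget ·ᵥ (λ _ → 0ℚ)) _ y ⟩
      (groundedGadget ·ᵥ (λ _ → 0ℚ)) y               ≡⟨ ·ᵥ-zeroʳ groundedGadget y ⟩
      0ℚ - 0ℚ                                        ≡⟨ cong₂ _-_ (δ-↑ʳ↑ˡ s y) (δ-↑ʳ↑ˡ t y) ⟨
      dipole (G s) (G t) (y ↑ˡ n)                    ∎
    on-G : ∀ i → (laplacian A ·ᵥ p) i - δ i v * 0ℚ ≡ dipole s t i
    on-G i = trans (cong (_- δ i v * 0ℚ) (potential i)) (drop (dipole s t i) (δ i v))
      where
      drop : ∀ a d → a - d * 0ℚ ≡ a
      drop = solve-∀ ℚ-ring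

  hat-potential-gadget-G : Loopless A → ∀ x {t p} → IsPotential (laplacian A) v t p →
    IsPotential (laplacian Â) (x ↑ˡ n) (G t) (lift (gadgetGreen x) p)
  hat-potential-gadget-G loopless x {t} {p} potential k =
    trans (laplacian-hat-lift loopless (gadgetGreen x) p k)
          (splitAt-≗ 3 {f = liftCurrent (gadgetGreen x) p} on-gadget on-G k)
    where
    on-gadget : ∀ y → liftCurrent (gadgetGreen x) p (y ↑ˡ n) ≡ dipole (x ↑ˡ n) (G t) (y ↑ˡ n)
    on-gadget y = begin
      liftCurrent (gadgetGreen x) p (y ↑ˡ n)            ≡⟨ lookup-++ˡ (groundedGadget ·ᵥ gadgetGreen x) _ y ⟩
      (groundedGadget ·ᵥ gadgetGreen x) y               ≡⟨ gadgetGreen-inverse x y ⟩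
      δ x y                                             ≡⟨ ℚ.+-identityʳ (δ x y) ⟨
      δ x y - 0ℚ                                        ≡⟨ cong₂ _-_ (δ-↑ˡ n x y) (δ-↑ʳ↑ˡ t y) ⟨
      dipole (x ↑ˡ n) (G t) (y ↑ˡ n)                    ∎
    on-G : ∀ i → (laplacian A ·ᵥ p) i - δ i v * sumℚ (gadgetGreen x) ≡ dipole (x ↑ˡ n) (G t) (G i)
    on-G i = begin
      (laplacian A ·ᵥ p) i - δ i v * sumℚ (gadgetGreen x)
        ≡⟨ cong₂ (λ a b → a - δ i v * b) (potential i) (sumℚ-gadgetGreen x) ⟩
      (δ v i - δ t i) - δ i v * 1ℚ
        ≡⟨ cong (λ d → (δ v i - δ t i) - d * 1ℚ) (δ-sym i v) ⟩
      (δ v i - δ t i) - δ v i * 1ℚ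
        ≡⟨ cancel (δ v i) (δ t i) ⟩
      0ℚ - δ t i
        ≡⟨ cong (_- δ t i) (δ-↑ˡ↑ʳ x i) ⟨
      dipole (x ↑ˡ n) (G t) (G i) ∎
      where
      cancel : ∀ a b → (a - b) - a * 1ℚ ≡ 0ℚ - b
      cancel = solve-∀ ℚ-ring

  hat-potential-gadget : Loopless A → ∀ x y →
    IsPotential (laplacian Â) (x ↑ˡ n) (y ↑ˡ n) (lift (λ z → gadgetGreen x z - gadgetGreen y z) (λ _ → 0ℚ))
  hat-potential-gadget loopless x y k =
    trans (laplacian-hat-lift loopless g (λ _ → 0ℚ) k)
          (splitAt-≗ 3 {f = liftCurrent g (λ _ → 0ℚ)} on-gadget on-G k)
    where
    g = λ z → gadgetGreen x z - gadgetGreen y z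
    on-gadget : ∀ z → liftCurrent g (λ _ → 0ℚ) (z ↑ˡ n) ≡ dipole (x ↑ˡ n) (y ↑ˡ n) (z ↑ˡ n)
    on-gadget z = begin
      liftCurrent g (λ _ → 0ℚ) (z ↑ˡ n)
        ≡⟨ lookup-++ˡ (groundedGadget ·ᵥ g) _ z ⟩
      (groundedGadget ·ᵥ g) z
        ≡⟨ ·ᵥ-distrib-- groundedGadget (gadgetGreen x) (gadgetGreen y) z ⟩
      (groundedGadget ·ᵥ gadgetGreen x) z - (groundedGadget ·ᵥ gadgetGreen y) z
                                                                     ≡⟨ cong₂ _-_ (gadgetGreen-inverse x z) (gadgetGreen-inverse y z) ⟩
      δ x z - δ y z
        ≡⟨ cong₂ _-_ (δ-↑ˡ n x z) (δ-↑ˡ n y z) ⟨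
      dipole (x ↑ˡ n) (y ↑ˡ n) (z ↑ˡ n) ∎
    on-G : ∀ i → (laplacian A ·ᵥ (λ _ → 0ℚ)) i - δ i v * sumℚ g ≡ dipole (x ↑ˡ n) (y ↑ˡ n) (G i)
    on-G i = begin
      (laplacian A ·ᵥ (λ _ → 0ℚ)) i - δ i v * sumℚ g
        ≡⟨ cong₂ (λ a b → a - δ i v * b) (·ᵥ-zeroʳ (laplacian A) i) Σg≡0 ⟩
      0ℚ - δ i v * 0ℚ
        ≡⟨ cong (λ z → 0ℚ - z) (ℚ.*-zeroʳ (δ i v)) ⟩
      0ℚ - 0ℚ
        ≡⟨ cong₂ _-_ (δ-↑ˡ↑ʳ x i) (δ-↑ˡ↑ʳ y i) ⟨
      dipole (x ↑ˡ n) (y ↑ˡ n) (G i) ∎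
      where
      Σg≡0 : sumℚ g ≡ 0ℚ
      Σg≡0 = trans (sumℚ-distrib-- (gadgetGreen x) (gadgetGreen y))
                   (cong₂ _-_ (sumℚ-gadgetGreen x) (sumℚ-gadgetGreen y))

  sumℚ-hat-degree-G : ∀ h →
    sumℚ (λ j → ℕtoℚ (degree Â (G j)) * h j) ≡ sumℚ (λ j → ℕtoℚ (degree A j) * h j) + ℕtoℚ 3 * h v
  sumℚ-hat-degree-G h = begin
    sumℚ (λ j → ℕtoℚ (degree Â (G j)) * h j)
      ≡⟨ sumℚ-cong (λ j → trans (cong (_* h j) (degree-hat-G j)) (distrib (D j) (δ j v) (h j))) ⟩
    sumℚ (λ j → D j * h j + ℕtoℚ 3 * (δ j v * h j))
      ≡⟨ sumℚ-distrib-+ (λ j → D j * h j) (λ j → ℕtoℚ 3 * (δ j v * h j)) ⟩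
    sumℚ (λ j → D j * h j) + sumℚ (λ j → ℕtoℚ 3 * (δ j v * h j))
      ≡⟨ cong (sumℚ (λ j → D j * h j) +_) (sumℚ-*ˡ (ℕtoℚ 3) (λ j → δ j v * h j)) ⟩
    sumℚ (λ j → D j * h j) + ℕtoℚ 3 * sumℚ (λ j → δ j v * h j)
      ≡⟨ cong (λ z → sumℚ (λ j → D j * h j) + ℕtoℚ 3 * z)
              (trans (sumℚ-cong (λ j → cong (_* h j) (δ-sym j v))) (sumℚ-δ v h)) ⟩
    sumℚ (λ j → D j * h j) + ℕtoℚ 3 * h v  ∎
    where
    D = ℕtoℚ ∘ degree A
    distrib : ∀ d e h → (d + ℕtoℚ 3 * e) * h ≡ d * h + ℕtoℚ 3 * (e * h)
    distrib = solve-∀ ℚ-ring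

  module _ {X : Matrix n} {Y : Matrix (3 +ℕ n)} (simple : IsSimple A) (connected : IsConnected A)
           (pinvX : IsPseudoInverse (laplacian A) X) (pinvY : IsPseudoInverse (laplacian Â) Y) where

    private
      potential : ∀ s t → IsPotential (laplacian A) s t (X ·ᵥ dipole s t)
      potential = pseudoinverse-potential simple connected pinvX

      resistance-G : ∀ {s t p} → IsPotential (laplacian A) s t p → resistance X s t ≡ p s - p t
      resistance-G {p = p} =
        resistance-potential {M = laplacian A} {Y = X} {p = p} (laplacian-symmetric simple) (proj₁ pinvX)

      resistance-Ĝ : ∀ {s t q} → IsPotential (laplacian Â) s t q → resistance Y s t ≡ q s - q t
      resistance-Ĝ {q = q} =
        resistance-potential {M = laplacian Â} {Y = Y} {p = q}
          (laplacian-symmetric (hat-simple simple)) (proj₁ pinvY)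

    resistance-hat-G : ∀ s t → resistance Y (G s) (G t) ≡ resistance X s t
    resistance-hat-G s t =
      trans (resistance-Ĝ {q = lift (λ _ → 0ℚ) (X ·ᵥ dipole s t)} (hat-potential-G (proj₁ simple) (potential s t)))
            (sym (resistance-G (potential s t)))

    resistance-hat-gadget-G : ∀ x t → resistance Y (x ↑ˡ n) (G t) ≡ gadgetGreen x x + resistance X v t
    resistance-hat-gadget-G x t = begin
      resistance Y (x ↑ˡ n) (G t)
        ≡⟨ resistance-Ĝ {q = lift (gadgetGreen x) p}
             (hat-potential-gadget-G (proj₁ simple) x (potential v t)) ⟩
      lift (gadgetGreen x) p (x ↑ˡ n) - p t
        ≡⟨ cong (_- p t) (lookup-++ˡ (λ y → p v + gadgetGreen x y) p x) ⟩
      (p v + gadgetGreen x x) - p t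
        ≡⟨ regroup (p v) (gadgetGreen x x) (p t) ⟩
      gadgetGreen x x + (p v - p t)
        ≡⟨ cong (gadgetGreen x x +_) (resistance-G (potential v t)) ⟨
      gadgetGreen x x + resistance X v t ∎
      where
      p = X ·ᵥ dipole v t
      regroup : ∀ a g b → (a + g) - b ≡ g + (a - b)
      regroup = solve-∀ ℚ-ring

    resistance-hat-gadget : ∀ x y → resistance Y (x ↑ˡ n) (y ↑ˡ n) ≡ resistance gadgetGreen x y
    resistance-hat-gadget x y = begin
      resistance Y (x ↑ˡ n) (y ↑ˡ n)
        ≡⟨ resistance-Ĝ {q = q} (hat-potential-gadget (proj₁ simple) x y) ⟩
      q (x ↑ˡ n) - q (y ↑ˡ n)
        ≡⟨ cong₂ _-_ (lookup-++ˡ _ (λ _ → 0ℚ) x) (lookup-++ˡ _ (λ _ → 0ℚ) y) ⟩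
      (0ℚ + (g x x - g y x)) - (0ℚ + (g x y - g y y))
        ≡⟨ regroup (g x x) (g y x) (g x y) (g y y) ⟩
      resistance gadgetGreen x y ∎
      where
      g = gadgetGreen
      q = lift (λ z → g x z - g y z) (λ _ → 0ℚ)
      regroup : ∀ a b c d → (0ℚ + (a - b)) - (0ℚ + (c - d)) ≡ (a + d) - (c + b)
      regroup = solve-∀ ℚ-ring

    private
      D : Fin n → ℚ
      D = ℕtoℚ ∘ degree A
      D̂ : Fin (3 +ℕ n) → ℚ
      D̂ = ℕtoℚ ∘ degree Â
      r = resistance X
      μ = moment A X v
      m = ℕtoℚ (edgeCount A)

    hat-cross-row : ∀ g → sumℚ (λ j → D̂ (G j) * (g + r v j)) ≡ g * (ℕtoℚ 2 * m + ℕtoℚ 3) + μ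
    hat-cross-row g = begin
      sumℚ (λ j → D̂ (G j) * (g + r v j))
        ≡⟨ sumℚ-hat-degree-G (λ j → g + r v j) ⟩
      sumℚ (λ j → D j * (g + r v j)) + ℕtoℚ 3 * (g + r v v)
        ≡⟨ cong₂ _+_ on-G (cong (λ z → ℕtoℚ 3 * (g + z)) (resistance-self X v)) ⟩
      (ℕtoℚ 2 * m * g + μ) + ℕtoℚ 3 * (g + 0ℚ)
        ≡⟨ collect (ℕtoℚ 2 * m) g μ ⟩
      g * (ℕtoℚ 2 * m + ℕtoℚ 3) + μ  ∎
      where
      on-G : sumℚ (λ j → D j * (g + r v j)) ≡ ℕtoℚ 2 * m * g + μ
      on-G = begin
        sumℚ (λ j → D j * (g + r v j))             ≡⟨ sumℚ-cong (λ j → ℚ.*-distribˡ-+ (D j) g (r v j)) ⟩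
        sumℚ (λ j → D j * g + D j * r v j)         ≡⟨ sumℚ-distrib-+ (λ j → D j * g) (λ j → D j * r v j) ⟩
        sumℚ (λ j → D j * g) + sumℚ (λ j → D j * r v j)
          ≡⟨ cong₂ _+_ (trans (sumℚ-*ʳ g D) (cong (_* g) (sumℚ-degree simple))) (sym (moment-swap A X v)) ⟩
        ℕtoℚ 2 * m * g + μ                         ∎
      collect : ∀ e g μ → (e * g + μ) + ℕtoℚ 3 * (g + 0ℚ) ≡ g * (e + ℕtoℚ 3) + μ
      collect = solve-∀ ℚ-ring

    hat-G-block : sumℚ (λ i → sumℚ (λ j → D̂ (G i) * D̂ (G j) * r i j)) ≡ degreeKirchhoff A X + ℕtoℚ 6 * μ
    hat-G-block = begin
      sumℚ (λ i → sumℚ (λ j → D̂ (G i) * D̂ (G j) * r i j))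
        ≡⟨ sumℚ-cong (λ i → trans (sumℚ-cong (λ j → ℚ.*-assoc (D̂ (G i)) (D̂ (G j)) (r i j)))
                                  (sumℚ-*ˡ (D̂ (G i)) (λ j → D̂ (G j) * r i j))) ⟩
      sumℚ (λ i → D̂ (G i) * sumℚ (λ j → D̂ (G j) * r i j))
        ≡⟨ sumℚ-cong (λ i → cong (D̂ (G i) *_) (sumℚ-hat-degree-G (r i))) ⟩
      sumℚ (λ i → D̂ (G i) * (F i + ℕtoℚ 3 * r i v))
        ≡⟨ sumℚ-hat-degree-G (λ i → F i + ℕtoℚ 3 * r i v) ⟩
      sumℚ (λ i → D i * (F i + ℕtoℚ 3 * r i v)) + ℕtoℚ 3 * (F v + ℕtoℚ 3 * r v v)
        ≡⟨ cong₂ _+_ on-G (cong₂ (λ a b → ℕtoℚ 3 * (a + ℕtoℚ 3 * b))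
                                 (sym (moment-swap A X v)) (resistance-self X v)) ⟩
      (degreeKirchhoff A X + ℕtoℚ 3 * μ) + ℕtoℚ 3 * (μ + ℕtoℚ 3 * 0ℚ)
        ≡⟨ collect (degreeKirchhoff A X) μ ⟩
      degreeKirchhoff A X + ℕtoℚ 6 * μ ∎
      where
      F : Fin n → ℚ
      F i = sumℚ (λ j → D j * r i j)
      distrib : ∀ d f s → d * (f + ℕtoℚ 3 * s) ≡ d * f + ℕtoℚ 3 * (d * s)
      distrib = solve-∀ ℚ-ring
      on-G : sumℚ (λ i → D i * (F i + ℕtoℚ 3 * r i v)) ≡ degreeKirchhoff A X + ℕtoℚ 3 * μ
      on-G = begin
        sumℚ (λ i → D i * (F i + ℕtoℚ 3 * r i v))
          ≡⟨ sumℚ-cong (λ i → distrib (D i) (F i) (r i v)) ⟩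
        sumℚ (λ i → D i * F i + ℕtoℚ 3 * (D i * r i v))
          ≡⟨ sumℚ-distrib-+ (λ i → D i * F i) (λ i → ℕtoℚ 3 * (D i * r i v)) ⟩
        sumℚ (λ i → D i * F i) + sumℚ (λ i → ℕtoℚ 3 * (D i * r i v))
          ≡⟨ cong₂ _+_ (sumℚ-cong (λ i → trans (sym (sumℚ-*ˡ (D i) (λ j → D j * r i j)))
                                            (sumℚ-cong (λ j → sym (ℚ.*-assoc (D i) (D j) (r i j))))))
                       (sumℚ-*ˡ (ℕtoℚ 3) (λ i → D i * r i v)) ⟩
        degreeKirchhoff A X + ℕtoℚ 3 * μ  ∎
      collect : ∀ S μ → (S + ℕtoℚ 3 * μ) + ℕtoℚ 3 * (μ + ℕtoℚ 3 * 0ℚ) ≡ S + ℕtoℚ 6 * μ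
      collect = solve-∀ ℚ-ring

    degreeKirchhoff-hat : degreeKirchhoff Â Y ≡
      degreeKirchhoff A X + ℕtoℚ 20 * μ + ℕtoℚ (16 *ℕ edgeCount A) + ℕtoℚ 47
    degreeKirchhoff-hat = begin
      degreeKirchhoff Â Y
        ≡⟨ sumℚ-blocks 3 f f-sym ⟩
      sumℚ (λ x → sumℚ (λ y → f (x ↑ˡ n) (y ↑ˡ n)))
        + ℕtoℚ 2 * sumℚ (λ x → sumℚ (λ j → f (x ↑ˡ n) (G j)))
        + sumℚ (λ i → sumℚ (λ j → f (G i) (G j)))
        ≡⟨ cong₂ _+_ (cong₂ (λ a b → a + ℕtoℚ 2 * b) gadget-block cross-block) G-block ⟩
      ℕtoℚ 23 + ℕtoℚ 2 * (ℕtoℚ 4 * (ℕtoℚ 2 * m + ℕtoℚ 3) + ℕtoℚ 7 * μ)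
        + (degreeKirchhoff A X + ℕtoℚ 6 * μ)
        ≡⟨ collect (degreeKirchhoff A X) μ m ⟩
      degreeKirchhoff A X + ℕtoℚ 20 * μ + ℕtoℚ 16 * m + ℕtoℚ 47
        ≡⟨ cong (λ z → degreeKirchhoff A X + ℕtoℚ 20 * μ + z + ℕtoℚ 47) (ℕtoℚ-homo-* 16 (edgeCount A)) ⟨
      degreeKirchhoff A X + ℕtoℚ 20 * μ + ℕtoℚ (16 *ℕ edgeCount A) + ℕtoℚ 47  ∎
      where
      f : Fin (3 +ℕ n) → Fin (3 +ℕ n) → ℚ
      f i j = D̂ i * D̂ j * resistance Y i j
      f-sym : ∀ i j → f i j ≡ f j i
      f-sym i j = cong₂ _*_ (ℚ.*-comm (D̂ i) (D̂ j)) (resistance-sym Y i j)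
      d : Fin 3 → ℚ
      d x = ℕtoℚ (suc (degree path₃ x))
      D̂-gadget : ∀ x → D̂ (x ↑ˡ n) ≡ d x
      D̂-gadget x = cong ℕtoℚ (degree-hat-gadget x)
      gadget-block : sumℚ (λ x → sumℚ (λ y → f (x ↑ˡ n) (y ↑ˡ n))) ≡ ℕtoℚ 23
      gadget-block = trans
        (sumℚ-cong (λ x → sumℚ-cong (λ y →
          cong₂ _*_ (cong₂ _*_ (D̂-gadget x) (D̂-gadget y)) (resistance-hat-gadget x y))))
        gadget-degreeKirchhoff
      cross-block : sumℚ (λ x → sumℚ (λ j → f (x ↑ˡ n) (G j)))
                    ≡ ℕtoℚ 4 * (ℕtoℚ 2 * m + ℕtoℚ 3) + ℕtoℚ 7 * μ
      cross-block = begin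
        sumℚ (λ x → sumℚ (λ j → f (x ↑ˡ n) (G j)))
          ≡⟨ sumℚ-cong (λ x → sumℚ-cong (λ j →
               ℚ.*-assoc (D̂ (x ↑ˡ n)) (D̂ (G j)) (resistance Y (x ↑ˡ n) (G j)))) ⟩
        sumℚ (λ x → sumℚ (λ j → D̂ (x ↑ˡ n) * (D̂ (G j) * resistance Y (x ↑ˡ n) (G j))))
          ≡⟨ sumℚ-cong (λ x → sumℚ-*ˡ (D̂ (x ↑ˡ n)) (λ j → D̂ (G j) * resistance Y (x ↑ˡ n) (G j))) ⟩
        sumℚ (λ x → D̂ (x ↑ˡ n) * sumℚ (λ j → D̂ (G j) * resistance Y (x ↑ˡ n) (G j)))
          ≡⟨ sumℚ-cong (λ x → cong₂ _*_ (D̂-gadget x)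
               (trans (sumℚ-cong (λ j → cong (D̂ (G j) *_) (resistance-hat-gadget-G x j)))
                      (hat-cross-row (gadgetGreen x x)))) ⟩
        sumℚ (λ x → d x * (gadgetGreen x x * (ℕtoℚ 2 * m + ℕtoℚ 3) + μ))
          ≡⟨ gadget-cross-weights (ℕtoℚ 2 * m + ℕtoℚ 3) μ ⟩
        ℕtoℚ 4 * (ℕtoℚ 2 * m + ℕtoℚ 3) + ℕtoℚ 7 * μ ∎
      G-block : sumℚ (λ i → sumℚ (λ j → f (G i) (G j))) ≡ degreeKirchhoff A X + ℕtoℚ 6 * μ
      G-block = trans
        (sumℚ-cong (λ i → sumℚ-cong (λ j → cong (D̂ (G i) * D̂ (G j) *_) (resistance-hat-G i j))))
        hat-G-block
      collect : ∀ S μ m →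
        ℕtoℚ 23 + ℕtoℚ 2 * (ℕtoℚ 4 * (ℕtoℚ 2 * m + ℕtoℚ 3) + ℕtoℚ 7 * μ) + (S + ℕtoℚ 6 * μ)
        ≡ S + ℕtoℚ 20 * μ + ℕtoℚ 16 * m + ℕtoℚ 47
      collect = solve-∀ ℚ-ring

lemma4p10 : (n : ℕ) (A : Adj n) (v : Fin n) →
    IsSimple A → IsConnected A → 1 ≤ edgeCount A →
    (X : Matrix n) → IsPseudoInverse (laplacian A) X →
    (Y : Matrix (suc (suc (suc n)))) → IsPseudoInverse (laplacian (hat A v)) Y →
    kemeny (hat A v) Y ≡
      (ℕtoℚ (4 *ℕ edgeCount A) * kemeny A X + ℕtoℚ 20 * moment A X v
        + ℕtoℚ (16 *ℕ edgeCount A) + ℕtoℚ 47)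
      * recip (4 *ℕ edgeCount A +ℕ 20)
lemma4p10 n A v simple connected 1≤m X pinvX Y pinvY = begin
  recip (4 *ℕ edgeCount (hat A v)) * degreeKirchhoff (hat A v) Y
    ≡⟨ cong₂ _*_ (cong recip 4m̂≡4m+20) (degreeKirchhoff-hat simple connected pinvX pinvY) ⟩
  recip (4 *ℕ m +ℕ 20) * total S                   ≡⟨ ℚ.*-comm (recip (4 *ℕ m +ℕ 20)) (total S) ⟩
  total S * recip (4 *ℕ m +ℕ 20)                   ≡⟨ cong (λ z → total z * recip (4 *ℕ m +ℕ 20)) 4m*kemeny≡S ⟨
  total (ℕtoℚ (4 *ℕ m) * kemeny A X) * recip (4 *ℕ m +ℕ 20) ∎
  where
  open Hat A v
  m = edgeCount A
  S = degreeKirchhoff A X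
  total : ℚ → ℚ
  total z = z + ℕtoℚ 20 * moment A X v + ℕtoℚ (16 *ℕ m) + ℕtoℚ 47
  4m̂≡4m+20 : 4 *ℕ edgeCount (hat A v) ≡ 4 *ℕ m +ℕ 20
  4m̂≡4m+20 = trans (cong (4 *ℕ_) edgeCount-hat) (trans (ℕ.*-distribˡ-+ 4 5 m) (ℕ.+-comm 20 (4 *ℕ m)))
  4m*kemeny≡S : ℕtoℚ (4 *ℕ m) * kemeny A X ≡ S
  4m*kemeny≡S = begin
    ℕtoℚ (4 *ℕ m) * (recip (4 *ℕ m) * S)  ≡⟨ ℚ.*-assoc (ℕtoℚ (4 *ℕ m)) (recip (4 *ℕ m)) S ⟨
    ℕtoℚ (4 *ℕ m) * recip (4 *ℕ m) * S    ≡⟨ cong (_* S) (ℕtoℚ*recip (ℕ.*-mono-≤ (s≤s (z≤n {3})) 1≤m)) ⟩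
    1ℚ * S                                ≡⟨ ℚ.*-identityˡ S ⟩
    S                                     ∎
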